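{- The components $<\mathbf{x}^{\mathbf{x}}$ are exactly $1$, $\mathbf{x}$, and $p^{\mathbf{x}}$ with $p\in\mathbb N$ prime.
   Context: $Sk$ is the smallest set of functions $\mathbb R^{>0}\to\mathbb R^{>0}$ containing the constant $1$ and the identity $\mathbf{x}$ and closed under $f+g$, $fg$, $f^g$, ordered by $f<g$ iff $f(x)<g(x)$ for all sufficiently large $x$. A Skolem function $f$ is a component if it cannot be written as a sum of two Skolem functions smaller than $f$ nor as a product of two Skolem functions smaller than $f$. -}

module Defs where

open import Data.Nat using (ℕ; zero; suc; _+_; _*_; _^_; _≤_; _<_)
open import Data.Nat.Primality using (Prime)
open import Data.Product using (Σ; ∃; _×_; _,_)
open import Relation.Binary.PropositionalEquality using (_≡_)
open import Relation.Nullary using (¬_)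

data Sk : Set where
  one : Sk
  X   : Sk
  _⊕_ : Sk → Sk → Sk
  _⊗_ : Sk → Sk → Sk
  _⊛_ : Sk → Sk → Sk

infixl 6 _⊕_
infixl 7 _⊗_
infixr 8 _⊛_

⟦_⟧ : Sk → ℕ → ℕ
⟦ one ⟧   n = 1
⟦ X ⟧     n = n
⟦ f ⊕ g ⟧ n = ⟦ f ⟧ n + ⟦ g ⟧ n
⟦ f ⊗ g ⟧ n = ⟦ f ⟧ n * ⟦ g ⟧ n
⟦ f ⊛ g ⟧ n = ⟦ f ⟧ n ^ ⟦ g ⟧ n

_≈_ : Sk → Sk → Set
f ≈ g = ∀ n → ⟦ f ⟧ (suc n) ≡ ⟦ g ⟧ (suc n)

_≺_ : Sk → Sk → Set
f ≺ g = ∃ λ N → ∀ n → N ≤ n → ⟦ f ⟧ n < ⟦ g ⟧ n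

IsComponent : Sk → Set
IsComponent f =
  ¬ (Σ Sk λ g → Σ Sk λ h → g ≺ f × h ≺ f × f ≈ (g ⊕ h)) ×
  ¬ (Σ Sk λ g → Σ Sk λ h → g ≺ f × h ≺ f × f ≈ (g ⊗ h))

numeral : ℕ → Sk
numeral zero          = one   -- unused for p = 0; primes are ≥ 2
numeral (suc zero)    = one
numeral (suc (suc k)) = numeral (suc k) ⊕ one

{-# OPTIONS --safe #-}

-- A component f ≺ X ⊛ X is not a sum, and a product or power splits into smaller factors unless
-- one side is the constant 1; so f is 1, X, or g ⊛ h with g, h ≥ 2. A constant exponent b ≥ 2
-- splits as g ^ b = g · g ^ (b - 1); any other exponent except X either splits the same way or
-- makes f ≥ x ^ x. In g ⊛ X the base must be a constant (else f ≥ x ^ x), and it is prime because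
-- (q d) ^ x = q ^ x · d ^ x.
-- Conversely, if p ^ x = g · h then at 1 one factor, say g, has value 1; such a g is ≡ 1 (mod p)
-- at 1 + p but divides p ^ (1 + p), so it is 1 there, and a term equal to 1 at an argument ≥ 2 is
-- 1 everywhere. If p ^ x = g + h with g, h smaller: every Skolem function either eventually
-- exceeds x ^ x or is an exponential polynomial Σ a n ^ k c ^ n, and below p ^ x all its bases are
-- < p, so g + h = O(n ^ K (p - 1) ^ n), which p ^ n outgrows.
module Submission where

open import Defs
open import Data.Nat using (ℕ)
open import Data.Nat.Primality using (Prime)
open import Data.Product using (Σ; _×_)
open import Data.Sum using (_⊎_)
open import Function.Bundles using (_⇔_)

open import Data.Nat.Base hiding (ℕ)
open import Data.Nat.Properties
open import Data.Nat.Divisibility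
  using (_∣_; _∤_; divides; ∣1⇒≡1; ∣m+n∣m⇒∣n; n∣n; hasNonTrivialDivisor;
         quotient; quotient-<; quotient≢0; m∣n⇒n≡quotient*m)
open import Data.Nat.Primality
  using (Composite; prime?; ¬prime⇒composite; euclidsLemma; prime⇒irreducible;
         prime⇒nonTrivial; prime⇒nonZero; ¬prime[0]; ¬prime[1])
open import Data.Nat.Tactic.RingSolver using (solve-∀)
open import Data.List.Base using (List; []; _∷_; _++_; map)
open import Data.Product using (∃; ∃₂; _,_; proj₁; proj₂)
open import Data.Sum using (inj₁; inj₂)
open import Data.Empty using (⊥-elim)
open import Relation.Nullary using (¬_; Dec; yes; no; contradiction)
open import Relation.Binary.PropositionalEquality
open import Function.Base using (_∘_)
open import Function.Bundles using (mk⇔)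

private variable
  P Q : ℕ → Set

-- Eventual dominance

Eventually : (ℕ → Set) → Set
Eventually P = ∃ λ N → ∀ n → N ≤ n → P n

_≼_ : Sk → Sk → Set
f ≼ g = Eventually λ n → ⟦ f ⟧ n ≤ ⟦ g ⟧ n

eventually-from : ∀ k → (∀ m → P (k + m)) → Eventually P
eventually-from {P} k p = k , holds
  where
  holds : ∀ n → k ≤ n → P n
  holds n k≤n with m≤n⇒∃[o]m+o≡n k≤n
  ... | o , refl = p o

eventually-both : Eventually P → Eventually Q → Eventually (λ n → P n × Q n)
eventually-both (M , p) (N , q) =
  M ⊔ N , λ n le → p n (≤-trans (m≤m⊔n M N) le) , q n (≤-trans (m≤n⊔m M N) le)

eventually-map : (∀ {n} → P n → Q n) → Eventually P → Eventually Q
eventually-map k (N , p) = N , λ n N≤n → k (p n N≤n)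

eventually-map⁺ : (∀ n → P (suc n) → Q (suc n)) → Eventually P → Eventually Q
eventually-map⁺ {P} {Q} k (N , p) = suc N , holds
  where
  holds : ∀ n → suc N ≤ n → Q n
  holds (suc n) (s≤s N≤n) = k n (p (suc n) (m≤n⇒m≤1+n N≤n))

eventually-witness : Eventually P → ∃ P
eventually-witness (N , p) = N , p N ≤-refl

≼⇒≯ : ∀ f g → f ≼ g → ¬ (g ≺ f)
≼⇒≯ _ _ f≼g g≺f with eventually-witness (eventually-both f≼g g≺f)
... | _ , f≤g , g<f = <⇒≱ g<f f≤g

≺-trans : ∀ f g h → f ≺ g → g ≺ h → f ≺ h
≺-trans _ _ _ f≺g g≺h with eventually-both f≺g g≺h
... | N , p = N , λ n le → <-trans (proj₁ (p n le)) (proj₂ (p n le))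

≈⇒≼ : ∀ f g → f ≈ g → f ≼ g
≈⇒≼ _ _ e = 1 , λ { (suc n) _ → ≤-reflexive (e n) }

≼-trans-≤ : ∀ f g h → f ≼ g → (∀ n → ⟦ g ⟧ (suc n) ≤ ⟦ h ⟧ (suc n)) → f ≼ h
≼-trans-≤ _ _ _ f≼g g≤h = eventually-map⁺ (λ n f≤g → ≤-trans f≤g (g≤h n)) f≼g

≺-respˡ-≈ : ∀ f g g′ → g ≈ g′ → g ≺ f → g′ ≺ f
≺-respˡ-≈ _ _ _ e = eventually-map⁺ λ n → subst (_< _) (e n)

≺-respʳ-≈ : ∀ g f f′ → f ≈ f′ → g ≺ f → g ≺ f′
≺-respʳ-≈ _ _ _ e = eventually-map⁺ λ n → subst (_ <_) (e n)

⟦⟧>0 : ∀ f n → ⟦ f ⟧ (suc n) > 0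
⟦⟧>0 one     n = s≤s z≤n
⟦⟧>0 X       n = s≤s z≤n
⟦⟧>0 (f ⊕ g) n = ≤-trans (⟦⟧>0 f n) (m≤m+n _ _)
⟦⟧>0 (f ⊗ g) n = *-mono-≤ (⟦⟧>0 f n) (⟦⟧>0 g n)
⟦⟧>0 (f ⊛ g) n = m^n>0 (⟦ f ⟧ (suc n)) {{>-nonZero (⟦⟧>0 f n)}} (⟦ g ⟧ (suc n))

⟦⟧≢0 : ∀ f n → NonZero (⟦ f ⟧ (suc n))
⟦⟧≢0 f n = >-nonZero (⟦⟧>0 f n)

⟦numeral⟧ : ∀ b .{{_ : NonZero b}} n → ⟦ numeral b ⟧ n ≡ b
⟦numeral⟧ 1             n = refl
⟦numeral⟧ (suc (suc k)) n = trans (cong (_+ 1) (⟦numeral⟧ (suc k) n)) (+-comm (suc k) 1)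

≡1⇒≈one : ∀ g m → ⟦ g ⟧ (2 + m) ≡ 1 → g ≈ one
≡1⇒≈one one     m _ n = refl
≡1⇒≈one X       m ()
≡1⇒≈one (f ⊕ g) m e =
  contradiction e (>⇒≢ (+-mono-≤ (⟦⟧>0 f (suc m)) (⟦⟧>0 g (suc m))))
≡1⇒≈one (f ⊗ g) m e n = cong₂ _*_ (≡1⇒≈one f m (m*n≡1⇒m≡1 _ _ e) n)
                                    (≡1⇒≈one g m (m*n≡1⇒n≡1 (⟦ f ⟧ (2 + m)) _ e) n)
≡1⇒≈one (f ⊛ g) m e n with m^n≡1⇒n≡0∨m≡1 (⟦ f ⟧ (2 + m)) (⟦ g ⟧ (2 + m)) e
... | inj₁ g≡0 = contradiction g≡0 (>⇒≢ (⟦⟧>0 g (suc m)))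
... | inj₂ f≡1 =
  trans (cong (_^ ⟦ g ⟧ (suc n)) (≡1⇒≈one f m f≡1 n)) (^-zeroˡ (⟦ g ⟧ (suc n)))

⊛-congˡ : ∀ g g′ h → g ≈ g′ → (g ⊛ h) ≈ (g′ ⊛ h)
⊛-congˡ _ _ h e n = cong (_^ ⟦ h ⟧ (suc n)) (e n)

⊛-congʳ : ∀ g h h′ → h ≈ h′ → (g ⊛ h) ≈ (g ⊛ h′)
⊛-congʳ g _ _ e n = cong (⟦ g ⟧ (suc n) ^_) (e n)

⊗-comm-≈ : ∀ f g → (f ⊗ g) ≈ (g ⊗ f)
⊗-comm-≈ f g n = *-comm (⟦ f ⟧ (suc n)) (⟦ g ⟧ (suc n))

⊗-oneˡ : ∀ f g → f ≈ one → (f ⊗ g) ≈ g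
⊗-oneˡ _ g e n = trans (cong (_* ⟦ g ⟧ (suc n)) (e n)) (*-identityˡ _)

⊗-oneʳ : ∀ f g → g ≈ one → (f ⊗ g) ≈ f
⊗-oneʳ f _ e n = trans (cong (⟦ f ⟧ (suc n) *_) (e n)) (*-identityʳ _)

⊛-oneˡ : ∀ f g → f ≈ one → (f ⊛ g) ≈ one
⊛-oneˡ _ g e n = trans (cong (_^ ⟦ g ⟧ (suc n)) (e n)) (^-zeroˡ (⟦ g ⟧ (suc n)))

⊛-oneʳ : ∀ f g → g ≈ one → (f ⊛ g) ≈ f
⊛-oneʳ f _ e n = trans (cong (⟦ f ⟧ (suc n) ^_) (e n)) (*-identityʳ _)

AtLeast2 : Sk → Set
AtLeast2 g = ∀ m → 2 ≤ ⟦ g ⟧ (2 + m)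

≈one-or-atLeast2 : ∀ g → g ≈ one ⊎ AtLeast2 g
≈one-or-atLeast2 g with ⟦ g ⟧ 2 ≟ 1
... | yes g₂≡1 = inj₁ (≡1⇒≈one g 0 g₂≡1)
... | no  g₂≢1 = inj₂ λ m → ≤∧≢⇒< (⟦⟧>0 g (suc m)) λ 1≡gₘ →
                   g₂≢1 (≡1⇒≈one g m (sym 1≡gₘ) 1)

Constant : Sk → Set
Constant g = ∃ λ c → ∀ n → ⟦ g ⟧ (suc n) ≡ c

AtLeastX : Sk → Set
AtLeastX g = ∀ n → suc n ≤ ⟦ g ⟧ (suc n)

constant≥2 : ∀ g {c} → (∀ n → ⟦ g ⟧ (suc n) ≡ c) → AtLeast2 g → 2 ≤ c
constant≥2 _ g≡c g≥2 = subst (2 ≤_) (g≡c 1) (g≥2 0)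

constant⇒¬atLeastX : ∀ g → Constant g → ¬ AtLeastX g
constant⇒¬atLeastX _ (c , g≡c) g≥x = <-irrefl (sym (g≡c c)) (g≥x c)

n<2^n : ∀ n → n < 2 ^ n
n<2^n zero    = s≤s z≤n
n<2^n (suc n) = subst (2 + n ≤_) (cong (2 ^ n +_) (sym (+-identityʳ (2 ^ n))))
                  (+-mono-≤ (m^n>0 2 n) (n<2^n n))

n≤m⇒n<a^m : ∀ {a n m} → 2 ≤ a → n ≤ m → n < a ^ m
n≤m⇒n<a^m {a} {n} {m} 2≤a n≤m =
  <-≤-trans (n<2^n n) (≤-trans (^-monoʳ-≤ 2 n≤m) (^-monoˡ-≤ m 2≤a))

m≤m^n : ∀ m {n} → n > 0 → m ≤ m ^ n
m≤m^n zero        _         = z≤n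
m≤m^n m@(suc _) {suc n} _ = m≤m*n m (m ^ n) {{m^n≢0 m n}}

^-distribʳ-* : ∀ m n o → (m * n) ^ o ≡ m ^ o * n ^ o
^-distribʳ-* m n zero    = refl
^-distribʳ-* m n (suc o) = begin
  m * n * (m * n) ^ o       ≡⟨ cong (m * n *_) (^-distribʳ-* m n o) ⟩
  m * n * (m ^ o * n ^ o)   ≡⟨ interchange m n (m ^ o) (n ^ o) ⟩
  m * m ^ o * (n * n ^ o)   ∎
  where
  open ≡-Reasoning
  interchange : ∀ a b c d → a * b * (c * d) ≡ a * c * (b * d)
  interchange = solve-∀

square≤2^ : ∀ m → (4 + m) * (4 + m) ≤ 2 ^ (4 + m)
square≤2^ zero    = ≤-refl
square≤2^ (suc m) = begin
  (5 + m) * (5 + m)                                 ≤⟨ m≤m+n _ _ ⟩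
  (5 + m) * (5 + m) + (7 + 6 * m + m * m)           ≡⟨ double-square m ⟩
  2 * ((4 + m) * (4 + m))                           ≤⟨ *-monoʳ-≤ 2 (square≤2^ m) ⟩
  2 * 2 ^ (4 + m)                                   ∎
  where
  open ≤-Reasoning
  double-square : ∀ m → (5 + m) * (5 + m) + (7 + 6 * m + m * m) ≡ 2 * ((4 + m) * (4 + m))
  double-square = solve-∀

n^n≤a^b : ∀ {a b} n → 2 ≤ a → n * n ≤ b → n ^ n ≤ a ^ b
n^n≤a^b {a} {b} n 2≤a n*n≤b = begin
  n ^ n         ≤⟨ ^-monoˡ-≤ n (<⇒≤ (n<2^n n)) ⟩
  (2 ^ n) ^ n   ≡⟨ ^-*-assoc 2 n n ⟩
  2 ^ (n * n)   ≤⟨ ^-monoʳ-≤ 2 n*n≤b ⟩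
  2 ^ b         ≤⟨ ^-monoˡ-≤ b 2≤a ⟩
  a ^ b         ∎
  where open ≤-Reasoning

constant-or-atLeastX : ∀ g → Constant g ⊎ AtLeastX g
constant-or-atLeastX one = inj₁ (1 , λ _ → refl)
constant-or-atLeastX X   = inj₂ λ _ → ≤-refl
constant-or-atLeastX (f ⊕ g) with constant-or-atLeastX f | constant-or-atLeastX g
... | inj₁ (a , f≡a) | inj₁ (b , g≡b) = inj₁ (a + b , λ n → cong₂ _+_ (f≡a n) (g≡b n))
... | inj₂ f≥x       | _              = inj₂ λ n → ≤-trans (f≥x n) (m≤m+n _ _)
... | inj₁ _         | inj₂ g≥x       = inj₂ λ n → ≤-trans (g≥x n) (m≤n+m _ _)
constant-or-atLeastX (f ⊗ g) with constant-or-atLeastX f | constant-or-atLeastX g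
... | inj₁ (a , f≡a) | inj₁ (b , g≡b) = inj₁ (a * b , λ n → cong₂ _*_ (f≡a n) (g≡b n))
... | inj₂ f≥x       | _              =
  inj₂ λ n → ≤-trans (f≥x n) (m≤m*n _ _ {{⟦⟧≢0 g n}})
... | inj₁ _         | inj₂ g≥x       =
  inj₂ λ n → ≤-trans (g≥x n) (m≤n*m _ _ {{⟦⟧≢0 f n}})
constant-or-atLeastX (f ⊛ g) with constant-or-atLeastX f | constant-or-atLeastX g
... | inj₁ (a , f≡a) | inj₁ (b , g≡b) = inj₁ (a ^ b , λ n → cong₂ _^_ (f≡a n) (g≡b n))
... | inj₂ f≥x       | _              = inj₂ λ n → ≤-trans (f≥x n) (m≤m^n _ (⟦⟧>0 g n))
... | inj₁ (a , f≡a) | inj₂ g≥x with ≈one-or-atLeast2 f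
...   | inj₁ f≈1 = inj₁ (1 , ⊛-oneˡ f g f≈1)
...   | inj₂ f≥2 = inj₂ λ n →
  <⇒≤ (n≤m⇒n<a^m (subst (2 ≤_) (sym (f≡a n)) (constant≥2 f f≡a f≥2)) (g≥x n))

-- Splitting terms into smaller summands and factors

IsComponent-resp-≈ : ∀ f f′ → f ≈ f′ → IsComponent f → IsComponent f′
IsComponent-resp-≈ f f′ e (¬sum , ¬product) =
  (λ { (g , h , g≺ , h≺ , e′) →
         ¬sum (g , h , smaller g g≺ , smaller h h≺ , via (g ⊕ h) e′) }) ,
  (λ { (g , h , g≺ , h≺ , e′) →
         ¬product (g , h , smaller g g≺ , smaller h h≺ , via (g ⊗ h) e′) })
  where
  smaller : ∀ g → g ≺ f′ → g ≺ f
  smaller g = ≺-respʳ-≈ g f′ f λ n → sym (e n)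
  via : ∀ g → f′ ≈ g → f ≈ g
  via _ e′ n = trans (e n) (e′ n)

LowComponent : Sk → Set
LowComponent f = IsComponent f × f ≺ (X ⊛ X)

LowComponent-resp-≈ : ∀ f f′ → f ≈ f′ → LowComponent f → LowComponent f′
LowComponent-resp-≈ f f′ e (c , f≺) =
  IsComponent-resp-≈ f f′ e c , ≺-respˡ-≈ (X ⊛ X) f f′ e f≺

¬component-⊕ : ∀ f g → ¬ IsComponent (f ⊕ g)
¬component-⊕ f g (¬sum , _) = ¬sum (f , g , f≺ , g≺ , λ _ → refl)
  where
  f≺ : f ≺ (f ⊕ g)
  f≺ = eventually-from 1 λ m → m<m+n _ (⟦⟧>0 g m)
  g≺ : g ≺ (f ⊕ g)
  g≺ = eventually-from 1 λ m → m<n+m _ (⟦⟧>0 f m)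

¬component-⊗ : ∀ f g → AtLeast2 f → AtLeast2 g → ¬ IsComponent (f ⊗ g)
¬component-⊗ f g f≥2 g≥2 (_ , ¬product) = ¬product (f , g , f≺ , g≺ , λ _ → refl)
  where
  f≺ : f ≺ (f ⊗ g)
  f≺ = eventually-from 2 λ m → m<m*n _ _ {{⟦⟧≢0 f (suc m)}} (g≥2 m)
  g≺ : g ≺ (f ⊗ g)
  g≺ = eventually-from 2 λ m →
    subst (⟦ g ⟧ (2 + m) <_) (*-comm (⟦ g ⟧ (2 + m)) (⟦ f ⟧ (2 + m)))
          (m<m*n _ _ {{⟦⟧≢0 g (suc m)}} (f≥2 m))

¬component-^-split : ∀ g h h₁ h₂ → AtLeast2 g → h ≈ (h₁ ⊕ h₂) →
                     ¬ IsComponent (g ⊛ h)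
¬component-^-split g h h₁ h₂ g≥2 e c =
  proj₂ (IsComponent-resp-≈ (g ⊛ h) (g ⊛ (h₁ ⊕ h₂)) (⊛-congʳ g h (h₁ ⊕ h₂) e) c)
    (g ⊛ h₁ , g ⊛ h₂ , ≺ʳ , ≺ˡ , λ n → ^-distribˡ-+-* _ (⟦ h₁ ⟧ (suc n)) _)
  where
  ≺ʳ : (g ⊛ h₁) ≺ (g ⊛ (h₁ ⊕ h₂))
  ≺ʳ = eventually-from 2 λ m →
    ^-monoʳ-< _ (g≥2 m) (m<m+n (⟦ h₁ ⟧ (2 + m)) (⟦⟧>0 h₂ (suc m)))
  ≺ˡ : (g ⊛ h₂) ≺ (g ⊛ (h₁ ⊕ h₂))
  ≺ˡ = eventually-from 2 λ m →
    ^-monoʳ-< _ (g≥2 m) (m<n+m (⟦ h₂ ⟧ (2 + m)) (⟦⟧>0 h₁ (suc m)))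

≈-constant-split : ∀ h c k → (∀ n → ⟦ c ⟧ (suc n) ≡ 2 + k) →
                   (h ⊗ c) ≈ (h ⊕ h ⊗ numeral (suc k))
≈-constant-split h c k c≡ n = begin
  hₙ * ⟦ c ⟧ (suc n)                     ≡⟨ cong (hₙ *_) (c≡ n) ⟩
  hₙ * (2 + k)                           ≡⟨ *-suc hₙ (suc k) ⟩
  hₙ + hₙ * suc k                        ≡⟨ cong (λ v → hₙ + hₙ * v) (⟦numeral⟧ (suc k) _) ⟨
  hₙ + hₙ * ⟦ numeral (suc k) ⟧ (suc n)  ∎
  where
  open ≡-Reasoning
  hₙ : ℕ
  hₙ = ⟦ h ⟧ (suc n)

¬component-^-constant : ∀ g h c → AtLeast2 g → Constant c → AtLeast2 c →
                        ¬ IsComponent (g ⊛ (h ⊗ c))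
¬component-^-constant g h c g≥2 (b , c≡b) c≥2 with constant≥2 c c≡b c≥2
... | s≤s (s≤s {n = k} _) =
  ¬component-^-split g (h ⊗ c) h (h ⊗ numeral (suc k)) g≥2 (≈-constant-split h c k c≡b)

⊛X-mono-≺ : ∀ f g → f ≺ g → (f ⊛ X) ≺ (g ⊛ X)
⊛X-mono-≺ _ _ = eventually-map⁺ λ n → ^-monoˡ-< (suc n)

numeral-mono-≺ : ∀ {j k} .{{_ : NonZero j}} .{{_ : NonZero k}} →
                 j < k → numeral j ≺ numeral k
numeral-mono-≺ {j} {k} j<k =
  eventually-from 0 λ m → subst₂ _<_ (sym (⟦numeral⟧ j m)) (sym (⟦numeral⟧ k m)) j<k

¬component-composite^X : ∀ {a} → Composite a → ¬ IsComponent (numeral a ⊛ X)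
¬component-composite^X {a} (hasNonTrivialDivisor {d} {{d-nonTrivial}} d<a d∣a) (_ , ¬product) =
  ¬product (numeral q ⊛ X , numeral d ⊛ X ,
            ⊛X-mono-≺ (numeral q) (numeral a) (numeral-mono-≺ (quotient-< d∣a)) ,
            ⊛X-mono-≺ (numeral d) (numeral a) (numeral-mono-≺ d<a) , split)
  where
  instance
    d≢0 : NonZero d
    d≢0 = nonTrivial⇒nonZero d
    a≢0 : NonZero a
    a≢0 = >-nonZero (<-trans (>-nonZero⁻¹ d) d<a)
  q : ℕ
  q = quotient d∣a
  instance
    q≢0 : NonZero q
    q≢0 = quotient≢0 d∣a
  split : (numeral a ⊛ X) ≈ ((numeral q ⊛ X) ⊗ (numeral d ⊛ X))
  split n = begin
    ⟦ numeral a ⟧ (suc n) ^ suc n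
      ≡⟨ cong (_^ suc n) (trans (⟦numeral⟧ a _) (m∣n⇒n≡quotient*m d∣a)) ⟩
    (q * d) ^ suc n
      ≡⟨ ^-distribʳ-* q d (suc n) ⟩
    q ^ suc n * d ^ suc n
      ≡⟨ cong₂ (λ x y → x ^ suc n * y ^ suc n) (⟦numeral⟧ q _) (⟦numeral⟧ d _) ⟨
    ⟦ (numeral q ⊛ X) ⊗ (numeral d ⊛ X) ⟧ (suc n)
      ∎
    where open ≡-Reasoning

-- Components below X ⊛ X

X^X≼⇒¬low : ∀ f → (X ⊛ X) ≼ f → ¬ LowComponent f
X^X≼⇒¬low f big (_ , f≺) = ≼⇒≯ (X ⊛ X) f big f≺

X^X≼-⊛ : ∀ g h → AtLeast2 g → (X ⊗ X) ≼ h → (X ⊛ X) ≼ (g ⊛ h)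
X^X≼-⊛ g h g≥2 x²≼h =
  eventually-map (λ { {n} (2≤g , n*n≤h) → n^n≤a^b n 2≤g n*n≤h })
    (eventually-both (eventually-from {λ n → 2 ≤ ⟦ g ⟧ n} 2 g≥2) x²≼h)

X²≼⇒¬low-⊛ : ∀ g h → AtLeast2 g → (X ⊗ X) ≼ h → ¬ LowComponent (g ⊛ h)
X²≼⇒¬low-⊛ g h g≥2 x²≼h = X^X≼⇒¬low (g ⊛ h) (X^X≼-⊛ g h g≥2 x²≼h)

X²≼-⊗ : ∀ h₁ h₂ → AtLeastX h₁ → AtLeastX h₂ → (X ⊗ X) ≼ (h₁ ⊗ h₂)
X²≼-⊗ h₁ h₂ h₁≥x h₂≥x = eventually-from 1 λ m → *-mono-≤ (h₁≥x m) (h₂≥x m)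

X²≼-⊛ˡ : ∀ h₁ h₂ → AtLeastX h₁ → AtLeast2 h₂ → (X ⊗ X) ≼ (h₁ ⊛ h₂)
X²≼-⊛ˡ h₁ h₂ h₁≥x h₂≥2 = eventually-from 2 λ m → begin
  (2 + m) * (2 + m)               ≡⟨ cong ((2 + m) *_) (*-identityʳ (2 + m)) ⟨
  (2 + m) ^ 2                     ≤⟨ ^-monoˡ-≤ 2 (h₁≥x (suc m)) ⟩
  ⟦ h₁ ⟧ (2 + m) ^ 2              ≤⟨ ^-monoʳ-≤ _ {{⟦⟧≢0 h₁ (suc m)}} (h₂≥2 m) ⟩
  ⟦ h₁ ⊛ h₂ ⟧ (2 + m)             ∎
  where open ≤-Reasoning

X²≼-⊛ʳ : ∀ h₁ h₂ → AtLeast2 h₁ → AtLeastX h₂ → (X ⊗ X) ≼ (h₁ ⊛ h₂)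
X²≼-⊛ʳ h₁ h₂ h₁≥2 h₂≥x = eventually-from 4 λ m → begin
  (4 + m) * (4 + m)               ≤⟨ square≤2^ m ⟩
  2 ^ (4 + m)                     ≤⟨ ^-monoˡ-≤ (4 + m) (h₁≥2 (2 + m)) ⟩
  ⟦ h₁ ⟧ (4 + m) ^ (4 + m)        ≤⟨ ^-monoʳ-≤ _ {{⟦⟧≢0 h₁ (3 + m)}} (h₂≥x (3 + m)) ⟩
  ⟦ h₁ ⊛ h₂ ⟧ (4 + m)             ∎
  where open ≤-Reasoning

ExponentIsX : Sk → Sk → Set
ExponentIsX g h = AtLeastX h → LowComponent (g ⊛ h) → h ≈ X

ExponentIsX-resp-≈ : ∀ g h h′ → h ≈ h′ → ExponentIsX g h′ → ExponentIsX g h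
ExponentIsX-resp-≈ g h h′ e claim h≥x low =
  λ n → trans (e n) (claim (λ n → subst (suc n ≤_) (e n) (h≥x n))
                           (LowComponent-resp-≈ (g ⊛ h) (g ⊛ h′) (⊛-congʳ g h h′ e) low) n)

exponentIsX : ∀ g h → AtLeast2 g → ExponentIsX g h
exponentIsX g one _ h≥x _ = ⊥-elim (constant⇒¬atLeastX one (1 , λ _ → refl) h≥x)
exponentIsX g X   _ _   _ = λ _ → refl
exponentIsX g (h₁ ⊕ h₂) g≥2 _ (c , _) =
  ⊥-elim (¬component-^-split g (h₁ ⊕ h₂) h₁ h₂ g≥2 (λ _ → refl) c)
exponentIsX g (h₁ ⊗ h₂) g≥2 with ≈one-or-atLeast2 h₁ | ≈one-or-atLeast2 h₂
... | inj₁ h₁≈1 | _ =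
  ExponentIsX-resp-≈ g (h₁ ⊗ h₂) h₂ (⊗-oneˡ h₁ h₂ h₁≈1) (exponentIsX g h₂ g≥2)
... | inj₂ _ | inj₁ h₂≈1 =
  ExponentIsX-resp-≈ g (h₁ ⊗ h₂) h₁ (⊗-oneʳ h₁ h₂ h₂≈1) (exponentIsX g h₁ g≥2)
... | inj₂ h₁≥2 | inj₂ h₂≥2 with constant-or-atLeastX h₁ | constant-or-atLeastX h₂
...   | inj₁ (a , h₁≡a) | inj₁ (b , h₂≡b) = λ h≥x _ → ⊥-elim
  (constant⇒¬atLeastX (h₁ ⊗ h₂) (a * b , λ n → cong₂ _*_ (h₁≡a n) (h₂≡b n)) h≥x)
...   | inj₂ h₁≥x | inj₂ h₂≥x = λ _ → ⊥-elim ∘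
  X²≼⇒¬low-⊛ g (h₁ ⊗ h₂) g≥2 (X²≼-⊗ h₁ h₂ h₁≥x h₂≥x)
...   | _ | inj₁ h₂-const = λ _ (c , _) →
  ⊥-elim (¬component-^-constant g h₁ h₂ g≥2 h₂-const h₂≥2 c)
...   | inj₁ h₁-const | _ = λ _ (c , _) →
  ⊥-elim (¬component-^-constant g h₂ h₁ g≥2 h₁-const h₁≥2
           (IsComponent-resp-≈ (g ⊛ (h₁ ⊗ h₂)) (g ⊛ (h₂ ⊗ h₁)) swap c))
  where
  swap : (g ⊛ (h₁ ⊗ h₂)) ≈ (g ⊛ (h₂ ⊗ h₁))
  swap = ⊛-congʳ g (h₁ ⊗ h₂) (h₂ ⊗ h₁) (⊗-comm-≈ h₁ h₂)
exponentIsX g (h₁ ⊛ h₂) g≥2 with ≈one-or-atLeast2 h₁ | ≈one-or-atLeast2 h₂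
... | inj₁ h₁≈1 | _ = λ h≥x _ →
  ⊥-elim (constant⇒¬atLeastX (h₁ ⊛ h₂) (1 , ⊛-oneˡ h₁ h₂ h₁≈1) h≥x)
... | inj₂ _ | inj₁ h₂≈1 =
  ExponentIsX-resp-≈ g (h₁ ⊛ h₂) h₁ (⊛-oneʳ h₁ h₂ h₂≈1) (exponentIsX g h₁ g≥2)
... | inj₂ h₁≥2 | inj₂ h₂≥2 with constant-or-atLeastX h₁ | constant-or-atLeastX h₂
...   | inj₁ (a , h₁≡a) | inj₁ (b , h₂≡b) = λ h≥x _ → ⊥-elim
  (constant⇒¬atLeastX (h₁ ⊛ h₂) (a ^ b , λ n → cong₂ _^_ (h₁≡a n) (h₂≡b n)) h≥x)
...   | inj₂ h₁≥x | _ = λ _ → ⊥-elim ∘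
  X²≼⇒¬low-⊛ g (h₁ ⊛ h₂) g≥2 (X²≼-⊛ˡ h₁ h₂ h₁≥x h₂≥2)
...   | inj₁ _ | inj₂ h₂≥x = λ _ → ⊥-elim ∘
  X²≼⇒¬low-⊛ g (h₁ ⊛ h₂) g≥2 (X²≼-⊛ʳ h₁ h₂ h₁≥2 h₂≥x)

baseIsPrime : ∀ g → AtLeast2 g → LowComponent (g ⊛ X) → ∃ λ p → Prime p × g ≈ numeral p
baseIsPrime g g≥2 low with constant-or-atLeastX g
... | inj₂ g≥x =
  ⊥-elim (X^X≼⇒¬low (g ⊛ X) (eventually-from 1 λ m → ^-monoˡ-≤ (suc m) (g≥x m)) low)
... | inj₁ (a , g≡a) = prime-or-composite (prime? a)
  where
  instance
    a-nonTrivial : NonTrivial a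
    a-nonTrivial = n>1⇒nonTrivial (constant≥2 g g≡a g≥2)
    a≢0 : NonZero a
    a≢0 = nonTrivial⇒nonZero a
  g≈a : g ≈ numeral a
  g≈a n = trans (g≡a n) (sym (⟦numeral⟧ a (suc n)))
  prime-or-composite : Dec (Prime a) → ∃ λ p → Prime p × g ≈ numeral p
  prime-or-composite (yes a-prime) = a , a-prime , g≈a
  prime-or-composite (no ¬a-prime) =
    ⊥-elim (¬component-composite^X (¬prime⇒composite ¬a-prime)
             (IsComponent-resp-≈ (g ⊛ X) (numeral a ⊛ X) (⊛-congˡ g (numeral a) X g≈a)
                                 (proj₁ low)))

OneXOrPrime^X : Sk → Set
OneXOrPrime^X f = f ≈ one ⊎ f ≈ X ⊎ Σ ℕ (λ p → Prime p × f ≈ (numeral p ⊛ X))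

OneXOrPrime^X-resp-≈ : ∀ f f′ → f ≈ f′ → OneXOrPrime^X f′ → OneXOrPrime^X f
OneXOrPrime^X-resp-≈ f f′ e (inj₁ f′≈1)       = inj₁ λ n → trans (e n) (f′≈1 n)
OneXOrPrime^X-resp-≈ f f′ e (inj₂ (inj₁ f′≈X)) = inj₂ (inj₁ λ n → trans (e n) (f′≈X n))
OneXOrPrime^X-resp-≈ f f′ e (inj₂ (inj₂ (p , p-prime , f′≈p^X))) =
  inj₂ (inj₂ (p , p-prime , λ n → trans (e n) (f′≈p^X n)))

Classified : Sk → Set
Classified f = LowComponent f → OneXOrPrime^X f

Classified-resp-≈ : ∀ f f′ → f ≈ f′ → Classified f′ → Classified f
Classified-resp-≈ f f′ e classify low =
  OneXOrPrime^X-resp-≈ f f′ e (classify (LowComponent-resp-≈ f f′ e low))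

classified : ∀ f → Classified f
classified one       _ = inj₁ λ _ → refl
classified X         _ = inj₂ (inj₁ λ _ → refl)
classified (f₁ ⊕ f₂) (c , _) = ⊥-elim (¬component-⊕ f₁ f₂ c)
classified (f₁ ⊗ f₂) with ≈one-or-atLeast2 f₁ | ≈one-or-atLeast2 f₂
... | inj₁ f₁≈1 | _ =
  Classified-resp-≈ (f₁ ⊗ f₂) f₂ (⊗-oneˡ f₁ f₂ f₁≈1) (classified f₂)
... | inj₂ _ | inj₁ f₂≈1 =
  Classified-resp-≈ (f₁ ⊗ f₂) f₁ (⊗-oneʳ f₁ f₂ f₂≈1) (classified f₁)
... | inj₂ f₁≥2 | inj₂ f₂≥2 = λ (c , _) →
  ⊥-elim (¬component-⊗ f₁ f₂ f₁≥2 f₂≥2 c)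
classified (f₁ ⊛ f₂) with ≈one-or-atLeast2 f₁ | ≈one-or-atLeast2 f₂
... | inj₁ f₁≈1 | _ = λ _ → inj₁ (⊛-oneˡ f₁ f₂ f₁≈1)
... | inj₂ _ | inj₁ f₂≈1 =
  Classified-resp-≈ (f₁ ⊛ f₂) f₁ (⊛-oneʳ f₁ f₂ f₂≈1) (classified f₁)
... | inj₂ f₁≥2 | inj₂ f₂≥2 with constant-or-atLeastX f₂
...   | inj₁ f₂-const = λ (c , _) →
  ⊥-elim (¬component-^-constant f₁ one f₂ f₁≥2 f₂-const f₂≥2
           (IsComponent-resp-≈ (f₁ ⊛ f₂) (f₁ ⊛ (one ⊗ f₂)) exponent-as-product c))
  where
  exponent-as-product : (f₁ ⊛ f₂) ≈ (f₁ ⊛ (one ⊗ f₂))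
  exponent-as-product = ⊛-congʳ f₁ f₂ (one ⊗ f₂) λ n → sym (*-identityˡ _)
...   | inj₂ f₂≥x = λ low →
  let f≈f₁^X : (f₁ ⊛ f₂) ≈ (f₁ ⊛ X)
      f≈f₁^X = ⊛-congʳ f₁ f₂ X (exponentIsX f₁ f₂ f₁≥2 f₂≥x low)
      p , p-prime , f₁≈p =
        baseIsPrime f₁ f₁≥2 (LowComponent-resp-≈ (f₁ ⊛ f₂) (f₁ ⊛ X) f≈f₁^X low)
  in inj₂ (inj₂ (p , p-prime , λ n →
       trans (f≈f₁^X n) (⊛-congˡ f₁ (numeral p) X f₁≈p n)))

numeral≺X : ∀ p → numeral p ≺ X
numeral≺X zero    = eventually-from 2 λ m → s≤s (s≤s z≤n)
numeral≺X (suc k) = eventually-from (2 + k) λ m →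
  subst (_< 2 + k + m) (sym (⟦numeral⟧ (suc k) (2 + k + m))) (s≤s (s≤s (m≤m+n k m)))

X≺X^X : X ≺ (X ⊛ X)
X≺X^X = eventually-from 2 λ m →
  m<m*n (2 + m) ((2 + m) ^ (1 + m))
        (<-≤-trans (s≤s (s≤s z≤n)) (m≤m^n (2 + m) {1 + m} (s≤s z≤n)))

numeral^X≺X^X : ∀ p → (numeral p ⊛ X) ≺ (X ⊛ X)
numeral^X≺X^X p = ⊛X-mono-≺ (numeral p) X (numeral≺X p)

-- Exponential polynomials

record ExpMonomial : Set where
  constructor mono
  field
    coefficient degree base : ℕ

⟦_⟧ᵐ : ExpMonomial → ℕ → ℕ
⟦ mono a k c ⟧ᵐ n = a * (n ^ k * c ^ n)

_*ᵐ_ : ExpMonomial → ExpMonomial → ExpMonomial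
mono a k c *ᵐ mono a′ k′ c′ = mono (a * a′) (k + k′) (c * c′)

⟦*ᵐ⟧ : ∀ s t n → ⟦ s *ᵐ t ⟧ᵐ n ≡ ⟦ s ⟧ᵐ n * ⟦ t ⟧ᵐ n
⟦*ᵐ⟧ (mono a k c) (mono a′ k′ c′) n = begin
  a * a′ * (n ^ (k + k′) * (c * c′) ^ n)
    ≡⟨ cong₂ (λ x y → a * a′ * (x * y)) (^-distribˡ-+-* n k k′) (^-distribʳ-* c c′ n) ⟩
  a * a′ * (n ^ k * n ^ k′ * (c ^ n * c′ ^ n))
    ≡⟨ regroup a a′ (n ^ k) (n ^ k′) (c ^ n) (c′ ^ n) ⟩
  a * (n ^ k * c ^ n) * (a′ * (n ^ k′ * c′ ^ n))
    ∎
  where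
  open ≡-Reasoning
  regroup : ∀ a a′ x x′ y y′ →
            a * a′ * (x * x′ * (y * y′)) ≡ a * (x * y) * (a′ * (x′ * y′))
  regroup = solve-∀

ExpPoly : Set
ExpPoly = List ExpMonomial

⟦_⟧ᴱ : ExpPoly → ℕ → ℕ
⟦ []    ⟧ᴱ n = 0
⟦ t ∷ P ⟧ᴱ n = ⟦ t ⟧ᵐ n + ⟦ P ⟧ᴱ n

⟦[_]⟧ : ∀ t n → ⟦ t ∷ [] ⟧ᴱ n ≡ ⟦ t ⟧ᵐ n
⟦[ t ]⟧ n = +-identityʳ (⟦ t ⟧ᵐ n)

⟦++⟧ : ∀ P Q n → ⟦ P ++ Q ⟧ᴱ n ≡ ⟦ P ⟧ᴱ n + ⟦ Q ⟧ᴱ n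
⟦++⟧ []      Q n = refl
⟦++⟧ (t ∷ P) Q n =
  trans (cong (⟦ t ⟧ᵐ n +_) (⟦++⟧ P Q n)) (sym (+-assoc (⟦ t ⟧ᵐ n) _ _))

_*ᴱ_ : ExpPoly → ExpPoly → ExpPoly
[]      *ᴱ Q = []
(s ∷ P) *ᴱ Q = map (s *ᵐ_) Q ++ P *ᴱ Q

⟦map-*ᵐ⟧ : ∀ s Q n → ⟦ map (s *ᵐ_) Q ⟧ᴱ n ≡ ⟦ s ⟧ᵐ n * ⟦ Q ⟧ᴱ n
⟦map-*ᵐ⟧ s []      n = sym (*-zeroʳ (⟦ s ⟧ᵐ n))
⟦map-*ᵐ⟧ s (t ∷ Q) n = begin
  ⟦ s *ᵐ t ⟧ᵐ n + ⟦ map (s *ᵐ_) Q ⟧ᴱ n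
    ≡⟨ cong₂ _+_ (⟦*ᵐ⟧ s t n) (⟦map-*ᵐ⟧ s Q n) ⟩
  ⟦ s ⟧ᵐ n * ⟦ t ⟧ᵐ n + ⟦ s ⟧ᵐ n * ⟦ Q ⟧ᴱ n
    ≡⟨ *-distribˡ-+ (⟦ s ⟧ᵐ n) _ _ ⟨
  ⟦ s ⟧ᵐ n * (⟦ t ⟧ᵐ n + ⟦ Q ⟧ᴱ n)
    ∎
  where open ≡-Reasoning

⟦*ᴱ⟧ : ∀ P Q n → ⟦ P *ᴱ Q ⟧ᴱ n ≡ ⟦ P ⟧ᴱ n * ⟦ Q ⟧ᴱ n
⟦*ᴱ⟧ []      Q n = refl
⟦*ᴱ⟧ (s ∷ P) Q n = begin
  ⟦ map (s *ᵐ_) Q ++ P *ᴱ Q ⟧ᴱ n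
    ≡⟨ ⟦++⟧ (map (s *ᵐ_) Q) (P *ᴱ Q) n ⟩
  ⟦ map (s *ᵐ_) Q ⟧ᴱ n + ⟦ P *ᴱ Q ⟧ᴱ n
    ≡⟨ cong₂ _+_ (⟦map-*ᵐ⟧ s Q n) (⟦*ᴱ⟧ P Q n) ⟩
  ⟦ s ⟧ᵐ n * ⟦ Q ⟧ᴱ n + ⟦ P ⟧ᴱ n * ⟦ Q ⟧ᴱ n
    ≡⟨ *-distribʳ-+ (⟦ Q ⟧ᴱ n) (⟦ s ⟧ᵐ n) _ ⟨
  (⟦ s ⟧ᵐ n + ⟦ P ⟧ᴱ n) * ⟦ Q ⟧ᴱ n
    ∎
  where open ≡-Reasoning

1ᴱ : ExpPoly
1ᴱ = mono 1 0 1 ∷ []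

⟦1ᴱ⟧ : ∀ n → ⟦ 1ᴱ ⟧ᴱ n ≡ 1
⟦1ᴱ⟧ n = trans (⟦[ mono 1 0 1 ]⟧ n) (trans (*-identityˡ _) (trans (*-identityˡ _) (^-zeroˡ n)))

xᴱ : ExpPoly
xᴱ = mono 1 1 1 ∷ []

⟦xᴱ⟧ : ∀ n → ⟦ xᴱ ⟧ᴱ n ≡ n
⟦xᴱ⟧ n = begin
  ⟦ xᴱ ⟧ᴱ n           ≡⟨ ⟦[ mono 1 1 1 ]⟧ n ⟩
  1 * (n ^ 1 * 1 ^ n) ≡⟨ *-identityˡ _ ⟩
  n ^ 1 * 1 ^ n       ≡⟨ cong₂ _*_ (^-identityʳ n) (^-zeroˡ n) ⟩
  n * 1               ≡⟨ *-identityʳ n ⟩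
  n                   ∎
  where open ≡-Reasoning

_^ᴱ_ : ExpPoly → ℕ → ExpPoly
P ^ᴱ zero  = 1ᴱ
P ^ᴱ suc k = P *ᴱ (P ^ᴱ k)

⟦^ᴱ⟧ : ∀ P k n → ⟦ P ^ᴱ k ⟧ᴱ n ≡ ⟦ P ⟧ᴱ n ^ k
⟦^ᴱ⟧ P zero    n = ⟦1ᴱ⟧ n
⟦^ᴱ⟧ P (suc k) n = trans (⟦*ᴱ⟧ P (P ^ᴱ k) n) (cong (⟦ P ⟧ᴱ n *_) (⟦^ᴱ⟧ P k n))

IsExpPoly : Sk → Set
IsExpPoly g = Σ ExpPoly λ P → ∀ n → ⟦ g ⟧ (suc n) ≡ ⟦ P ⟧ᴱ (suc n)

Affine : (ℕ → ℕ) → Set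
Affine u = ∃₂ λ α β → ∀ n → u (suc n) ≡ α * suc n + β

AtLeastSquare : (ℕ → ℕ) → Set
AtLeastSquare u = Eventually λ n → n * n ≤ u n

monomial-affine-or-atLeastSquare : ∀ t → Affine ⟦ t ⟧ᵐ ⊎ AtLeastSquare ⟦ t ⟧ᵐ
monomial-affine-or-atLeastSquare (mono zero k c) = inj₁ (0 , 0 , λ _ → refl)
monomial-affine-or-atLeastSquare (mono a k zero) =
  inj₁ (0 , 0 , λ n → trans (cong (a *_) (*-zeroʳ (suc n ^ k))) (*-zeroʳ a))
monomial-affine-or-atLeastSquare (mono a zero (suc zero)) =
  inj₁ (0 , a , λ n →
          trans (cong (a *_) (trans (*-identityˡ _) (^-zeroˡ (suc n)))) (*-identityʳ a))
monomial-affine-or-atLeastSquare (mono a (suc zero) (suc zero)) = inj₁ (a , 0 , λ n → begin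
  a * (suc n ^ 1 * 1 ^ suc n)
    ≡⟨ cong (a *_) (cong₂ _*_ (^-identityʳ (suc n)) (^-zeroˡ (suc n))) ⟩
  a * (suc n * 1)
    ≡⟨ cong (a *_) (*-identityʳ (suc n)) ⟩
  a * suc n
    ≡⟨ +-identityʳ (a * suc n) ⟨
  a * suc n + 0
    ∎)
  where open ≡-Reasoning
monomial-affine-or-atLeastSquare (mono a@(suc _) (suc (suc k)) (suc zero)) =
  inj₂ (eventually-from 1 λ m → begin
    suc m * suc m                          ≤⟨ *-monoʳ-≤ (suc m) (m≤m*n _ _ {{m^n≢0 (suc m) k}}) ⟩
    suc m ^ (2 + k)                        ≡⟨ *-identityʳ _ ⟨
    suc m ^ (2 + k) * 1                    ≡⟨ cong (suc m ^ (2 + k) *_) (^-zeroˡ (suc m)) ⟨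
    suc m ^ (2 + k) * 1 ^ suc m            ≤⟨ m≤n*m _ a ⟩
    a * (suc m ^ (2 + k) * 1 ^ suc m)      ∎)
  where open ≤-Reasoning
monomial-affine-or-atLeastSquare (mono a@(suc _) k c@(suc (suc _))) =
  inj₂ (eventually-from 4 λ m → begin
    (4 + m) * (4 + m)                      ≤⟨ square≤2^ m ⟩
    2 ^ (4 + m)                            ≤⟨ ^-monoˡ-≤ (4 + m) (s≤s (s≤s z≤n)) ⟩
    c ^ (4 + m)                            ≤⟨ m≤n*m _ ((4 + m) ^ k) {{m^n≢0 (4 + m) k}} ⟩
    (4 + m) ^ k * c ^ (4 + m)              ≤⟨ m≤n*m _ a ⟩
    a * ((4 + m) ^ k * c ^ (4 + m))        ∎)
  where open ≤-Reasoning

expPoly-affine-or-atLeastSquare : ∀ P → Affine ⟦ P ⟧ᴱ ⊎ AtLeastSquare ⟦ P ⟧ᴱ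
expPoly-affine-or-atLeastSquare [] = inj₁ (0 , 0 , λ _ → refl)
expPoly-affine-or-atLeastSquare (t ∷ P)
  with monomial-affine-or-atLeastSquare t | expPoly-affine-or-atLeastSquare P
... | inj₂ t≥² | _ = inj₂ (eventually-map (λ le → ≤-trans le (m≤m+n _ _)) t≥²)
... | inj₁ _ | inj₂ P≥² = inj₂ (eventually-map (λ le → ≤-trans le (m≤n+m _ _)) P≥²)
... | inj₁ (α , β , t≡) | inj₁ (α′ , β′ , P≡) =
  inj₁ (α + α′ , β + β′ , λ n →
          trans (cong₂ _+_ (t≡ n) (P≡ n)) (collect α β α′ β′ (suc n)))
  where
  collect : ∀ a b a′ b′ x → a * x + b + (a′ * x + b′) ≡ (a + a′) * x + (b + b′)
  collect = solve-∀

X^X≼-or-expPoly-^constant : ∀ a b → Constant b → (X ⊛ X) ≼ a ⊎ IsExpPoly a →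
                            (X ⊛ X) ≼ (a ⊛ b) ⊎ IsExpPoly (a ⊛ b)
X^X≼-or-expPoly-^constant a b _ (inj₁ a-big) =
  inj₁ (≼-trans-≤ (X ⊛ X) a (a ⊛ b) a-big λ n → m≤m^n _ (⟦⟧>0 b n))
X^X≼-or-expPoly-^constant a b (k , b≡k) (inj₂ (P , a≡P)) =
  inj₂ (P ^ᴱ k , λ n → trans (cong₂ _^_ (a≡P n) (b≡k n)) (sym (⟦^ᴱ⟧ P k (suc n))))

X^X≼-or-expPoly-constant^ : ∀ a b → Constant a → AtLeast2 a → (X ⊛ X) ≼ b ⊎ IsExpPoly b →
                            (X ⊛ X) ≼ (a ⊛ b) ⊎ IsExpPoly (a ⊛ b)
X^X≼-or-expPoly-constant^ a b (c , a≡c) a≥2 (inj₁ b-big) =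
  inj₁ (≼-trans-≤ (X ⊛ X) b (a ⊛ b) b-big λ n →
          <⇒≤ (n≤m⇒n<a^m (subst (2 ≤_) (sym (a≡c n)) (constant≥2 a a≡c a≥2)) ≤-refl))
X^X≼-or-expPoly-constant^ a b (c , a≡c) a≥2 (inj₂ (P , b≡P))
  with expPoly-affine-or-atLeastSquare P
... | inj₁ (α , β , P≡) = inj₂ (mono (c ^ β) 0 (c ^ α) ∷ [] , λ n → begin
  ⟦ a ⟧ (suc n) ^ ⟦ b ⟧ (suc n)       ≡⟨ cong₂ _^_ (a≡c n) (trans (b≡P n) (P≡ n)) ⟩
  c ^ (α * suc n + β)                 ≡⟨ ^-distribˡ-+-* c (α * suc n) β ⟩
  c ^ (α * suc n) * c ^ β             ≡⟨ cong (_* c ^ β) (^-*-assoc c α (suc n)) ⟨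
  (c ^ α) ^ suc n * c ^ β             ≡⟨ *-comm _ (c ^ β) ⟩
  c ^ β * (c ^ α) ^ suc n             ≡⟨ cong (c ^ β *_) (*-identityˡ _) ⟨
  ⟦ mono (c ^ β) 0 (c ^ α) ⟧ᵐ (suc n) ≡⟨ ⟦[ mono (c ^ β) 0 (c ^ α) ]⟧ (suc n) ⟨
  ⟦ mono (c ^ β) 0 (c ^ α) ∷ [] ⟧ᴱ (suc n) ∎)
  where open ≡-Reasoning
... | inj₂ P≥² =
  inj₁ (X^X≼-⊛ a b a≥2 (eventually-map⁺ (λ n → subst (_ ≤_) (sym (b≡P n))) P≥²))

X^X≼-or-expPoly : ∀ g → (X ⊛ X) ≼ g ⊎ IsExpPoly g
X^X≼-or-expPoly one = inj₂ (1ᴱ , λ n → sym (⟦1ᴱ⟧ (suc n)))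
X^X≼-or-expPoly X   = inj₂ (xᴱ , λ n → sym (⟦xᴱ⟧ (suc n)))
X^X≼-or-expPoly (a ⊕ b) with X^X≼-or-expPoly a | X^X≼-or-expPoly b
... | inj₁ a-big | _ = inj₁ (≼-trans-≤ (X ⊛ X) a (a ⊕ b) a-big λ _ → m≤m+n _ _)
... | inj₂ _ | inj₁ b-big = inj₁ (≼-trans-≤ (X ⊛ X) b (a ⊕ b) b-big λ _ → m≤n+m _ _)
... | inj₂ (P , a≡P) | inj₂ (Q , b≡Q) =
  inj₂ (P ++ Q , λ n → trans (cong₂ _+_ (a≡P n) (b≡Q n)) (sym (⟦++⟧ P Q (suc n))))
X^X≼-or-expPoly (a ⊗ b) with X^X≼-or-expPoly a | X^X≼-or-expPoly b
... | inj₁ a-big | _ =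
  inj₁ (≼-trans-≤ (X ⊛ X) a (a ⊗ b) a-big λ n → m≤m*n _ _ {{⟦⟧≢0 b n}})
... | inj₂ _ | inj₁ b-big =
  inj₁ (≼-trans-≤ (X ⊛ X) b (a ⊗ b) b-big λ n → m≤n*m _ _ {{⟦⟧≢0 a n}})
... | inj₂ (P , a≡P) | inj₂ (Q , b≡Q) =
  inj₂ (P *ᴱ Q , λ n → trans (cong₂ _*_ (a≡P n) (b≡Q n)) (sym (⟦*ᴱ⟧ P Q (suc n))))
X^X≼-or-expPoly (a ⊛ b) with constant-or-atLeastX b
... | inj₁ b-const = X^X≼-or-expPoly-^constant a b b-const (X^X≼-or-expPoly a)
... | inj₂ b≥x with ≈one-or-atLeast2 a | constant-or-atLeastX a
...   | inj₁ a≈1 | _ = inj₂ (1ᴱ , λ n → trans (⊛-oneˡ a b a≈1 n) (sym (⟦1ᴱ⟧ (suc n))))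
...   | inj₂ a≥2 | inj₁ a-const = X^X≼-or-expPoly-constant^ a b a-const a≥2 (X^X≼-or-expPoly b)
...   | inj₂ _   | inj₂ a≥x = inj₁ (eventually-from 1 λ m →
  ≤-trans (^-monoˡ-≤ (suc m) (a≥x m)) (^-monoʳ-≤ _ {{⟦⟧≢0 a m}} (b≥x m)))

-- Growth of exponential polynomials

PolyExpBounded : ℕ → (ℕ → ℕ) → Set
PolyExpBounded q u = ∃₂ λ A K → ∀ n → u (suc n) ≤ ⟦ mono A K q ⟧ᵐ (suc n)

polyExpBounded-+ : ∀ q u v → PolyExpBounded q u → PolyExpBounded q v →
                   PolyExpBounded q (λ n → u n + v n)
polyExpBounded-+ q u v (A , K , u≤) (B , L , v≤) = A + B , K + L , λ n → begin
  u (suc n) + v (suc n)                                   ≤⟨ +-mono-≤ (u≤ n) (v≤ n) ⟩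
  ⟦ mono A K q ⟧ᵐ (suc n) + ⟦ mono B L q ⟧ᵐ (suc n)
    ≤⟨ +-mono-≤ (raise-degree n A (m≤m+n K L)) (raise-degree n B (m≤n+m L K)) ⟩
  ⟦ mono A (K + L) q ⟧ᵐ (suc n) + ⟦ mono B (K + L) q ⟧ᵐ (suc n) ≡⟨ *-distribʳ-+ _ A B ⟨
  ⟦ mono (A + B) (K + L) q ⟧ᵐ (suc n)                     ∎
  where
  open ≤-Reasoning
  raise-degree : ∀ n A {K K′} → K ≤ K′ →
                 ⟦ mono A K q ⟧ᵐ (suc n) ≤ ⟦ mono A K′ q ⟧ᵐ (suc n)
  raise-degree n A K≤K′ = *-monoʳ-≤ A (*-monoˡ-≤ (q ^ suc n) (^-monoʳ-≤ (suc n) K≤K′))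

ExpAbove : ℕ → (ℕ → ℕ) → Set
ExpAbove q u = ∀ n → suc q ^ suc n ≤ u (suc n)

monomial-bounded-or-above : ∀ q t → PolyExpBounded q ⟦ t ⟧ᵐ ⊎ ExpAbove q ⟦ t ⟧ᵐ
monomial-bounded-or-above q (mono zero k c) = inj₁ (0 , 0 , λ _ → z≤n)
monomial-bounded-or-above q (mono a@(suc _) k c) with c ≤? q
... | yes c≤q =
  inj₁ (a , k , λ n → *-monoʳ-≤ a (*-monoʳ-≤ (suc n ^ k) (^-monoˡ-≤ (suc n) c≤q)))
... | no  c≰q = inj₂ λ n → begin
  suc q ^ suc n                  ≤⟨ ^-monoˡ-≤ (suc n) (≰⇒> c≰q) ⟩
  c ^ suc n                      ≤⟨ m≤n*m _ (suc n ^ k) {{m^n≢0 (suc n) k}} ⟩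
  suc n ^ k * c ^ suc n          ≤⟨ m≤n*m _ a ⟩
  a * (suc n ^ k * c ^ suc n)    ∎
  where open ≤-Reasoning

expPoly-bounded-or-above : ∀ q P → PolyExpBounded q ⟦ P ⟧ᴱ ⊎ ExpAbove q ⟦ P ⟧ᴱ
expPoly-bounded-or-above q [] = inj₁ (0 , 0 , λ _ → z≤n)
expPoly-bounded-or-above q (t ∷ P) with monomial-bounded-or-above q t | expPoly-bounded-or-above q P
... | inj₂ t-above | _ = inj₂ λ n → ≤-trans (t-above n) (m≤m+n _ _)
... | inj₁ _ | inj₂ P-above = inj₂ λ n → ≤-trans (P-above n) (m≤n+m _ _)
... | inj₁ t-bounded | inj₁ P-bounded =
  inj₁ (polyExpBounded-+ q ⟦ t ⟧ᵐ ⟦ P ⟧ᴱ t-bounded P-bounded)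

bernoulli : ∀ q j → q ^ j * (q + j) ≤ q * suc q ^ j
bernoulli q zero = ≤-reflexive (base q)
  where
  base : ∀ q → 1 * (q + 0) ≡ q * 1
  base = solve-∀
bernoulli q (suc j) = begin
  q * q ^ j * (q + suc j)               ≡⟨ split q (q ^ j) j ⟩
  q * (q ^ j * (q + j)) + q * q ^ j     ≤⟨ +-mono-≤ (*-monoʳ-≤ q (bernoulli q j))
                                                    (*-monoʳ-≤ q (^-monoˡ-≤ j (n≤1+n q))) ⟩
  q * (q * suc q ^ j) + q * suc q ^ j   ≡⟨ merge q (suc q ^ j) ⟩
  q * (suc q * suc q ^ j)               ∎
  where
  open ≤-Reasoning
  split : ∀ q x j → q * x * (q + suc j) ≡ q * (x * (q + j)) + q * x
  split = solve-∀
  merge : ∀ q y → q * (q * y) + q * y ≡ q * (suc q * y)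
  merge = solve-∀

2*q^q≤[1+q]^q : ∀ q .{{_ : NonZero q}} → 2 * q ^ q ≤ suc q ^ q
2*q^q≤[1+q]^q q = *-cancelˡ-≤ q (subst (_≤ q * suc q ^ q) (rearrange q (q ^ q)) (bernoulli q q))
  where
  rearrange : ∀ q x → x * (q + q) ≡ q * (2 * x)
  rearrange = solve-∀

2^m*q^[q*m]≤[1+q]^[q*m] : ∀ q .{{_ : NonZero q}} m → 2 ^ m * q ^ (q * m) ≤ suc q ^ (q * m)
2^m*q^[q*m]≤[1+q]^[q*m] q m = begin
  2 ^ m * q ^ (q * m)     ≡⟨ cong (2 ^ m *_) (^-*-assoc q q m) ⟨
  2 ^ m * (q ^ q) ^ m     ≡⟨ ^-distribʳ-* 2 (q ^ q) m ⟨
  (2 * q ^ q) ^ m         ≤⟨ ^-monoˡ-≤ m (2*q^q≤[1+q]^q q) ⟩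
  (suc q ^ q) ^ m         ≡⟨ ^-*-assoc (suc q) q m ⟩
  suc q ^ (q * m)         ∎
  where open ≤-Reasoning

affine≤2^ : ∀ B K → ∃ λ j → B + j * K ≤ 2 ^ j
affine≤2^ B K = i + i , (begin
  B + (i + i) * K           ≤⟨ +-monoˡ-≤ ((i + i) * K) (m≤n*m B i) ⟩
  i * B + (i + i) * K       ≡⟨ expand i B K ⟩
  (B + K + K) * i           ≤⟨ m≤n+m _ i ⟩
  i * i                     ≤⟨ *-mono-≤ (<⇒≤ (n<2^n i)) (<⇒≤ (n<2^n i)) ⟩
  2 ^ i * 2 ^ i             ≡⟨ ^-distribˡ-+-* 2 i i ⟨
  2 ^ (i + i)               ∎)
  where
  open ≤-Reasoning
  i : ℕ
  i = suc (B + K + K)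
  expand : ∀ i B K → i * B + (i + i) * K ≡ (B + K + K) * i
  expand = solve-∀

polynomial<2^ : ∀ B K → ∃ λ m → m > 0 × B * m ^ K < 2 ^ m
polynomial<2^ B K with affine≤2^ B K
... | j , B+jK≤2^j = 2 ^ j , m^n>0 2 j , (begin-strict
  B * (2 ^ j) ^ K       ≡⟨ cong (B *_) (^-*-assoc 2 j K) ⟩
  B * 2 ^ (j * K)       <⟨ *-monoˡ-< (2 ^ (j * K)) {{m^n≢0 2 (j * K)}} (n<2^n B) ⟩
  2 ^ B * 2 ^ (j * K)   ≡⟨ ^-distribˡ-+-* 2 B (j * K) ⟨
  2 ^ (B + j * K)       ≤⟨ ^-monoʳ-≤ 2 B+jK≤2^j ⟩
  2 ^ (2 ^ j)           ∎)
  where open ≤-Reasoning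

-- For q ≥ 1 take n = q m with A q ^ K m ^ K < 2 ^ m; then A n ^ K q ^ n < 2 ^ m q ^ n ≤ (1 + q) ^ n
-- because (1 + 1/q) ^ q ≥ 2.
exponential-beats-polyExp : ∀ q A K → ∃ λ n → ⟦ mono A K q ⟧ᵐ (suc n) < suc q ^ suc n
exponential-beats-polyExp zero A K =
  0 , subst (_< 1) (sym (trans (cong (A *_) (*-zeroʳ (1 ^ K))) (*-zeroʳ A))) (s≤s z≤n)
exponential-beats-polyExp q@(suc r) A K with polynomial<2^ (A * q ^ K) K
... | suc m′ , _ , lt = m′ + r * suc m′ , (begin-strict
  A * ((q * m) ^ K * q ^ (q * m))     ≡⟨ cong (λ x → A * (x * q ^ (q * m))) (^-distribʳ-* q m K) ⟩
  A * (q ^ K * m ^ K * q ^ (q * m))   ≡⟨ regroup A (q ^ K) (m ^ K) (q ^ (q * m)) ⟩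
  A * q ^ K * m ^ K * q ^ (q * m)     <⟨ *-monoˡ-< (q ^ (q * m)) {{m^n≢0 q (q * m)}} lt ⟩
  2 ^ m * q ^ (q * m)                 ≤⟨ 2^m*q^[q*m]≤[1+q]^[q*m] q m ⟩
  suc q ^ (q * m)                     ∎)
  where
  open ≤-Reasoning
  m : ℕ
  m = suc m′
  regroup : ∀ a x y z → a * (x * y * z) ≡ a * x * y * z
  regroup = solve-∀

¬polyExpBounded-[1+q]^ : ∀ q → ¬ PolyExpBounded q (suc q ^_)
¬polyExpBounded-[1+q]^ q (A , K , bounded) with exponential-beats-polyExp q A K
... | n , lt = <⇒≱ lt (bounded n)

below-[1+q]^X⇒polyExpBounded : ∀ q g → g ≺ (numeral (suc q) ⊛ X) → PolyExpBounded q ⟦ g ⟧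
below-[1+q]^X⇒polyExpBounded q g g≺ with X^X≼-or-expPoly g
... | inj₁ g-big = ⊥-elim (≼⇒≯ (X ⊛ X) g g-big
                            (≺-trans g (numeral (suc q) ⊛ X) (X ⊛ X) g≺ (numeral^X≺X^X (suc q))))
... | inj₂ (P , g≡P) with expPoly-bounded-or-above q P
...   | inj₁ (A , K , P≤) = A , K , λ n → subst (_≤ _) (sym (g≡P n)) (P≤ n)
...   | inj₂ P-above = ⊥-elim (≼⇒≯ (numeral (suc q) ⊛ X) g (1 , above) g≺)
  where
  above : ∀ n → 1 ≤ n → ⟦ numeral (suc q) ⊛ X ⟧ n ≤ ⟦ g ⟧ n
  above (suc n) _ =
    subst₂ _≤_ (cong (_^ suc n) (sym (⟦numeral⟧ (suc q) (suc n)))) (sym (g≡P n)) (P-above n)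

-- Components of the forms 1, X and p ⊛ X

¬≺one : ∀ g → ¬ (g ≺ one)
¬≺one g = ≼⇒≯ one g (eventually-from 1 (⟦⟧>0 g))

one-isComponent : IsComponent one
one-isComponent =
  (λ { (g , _ , g≺ , _) → ¬≺one g g≺ }) , (λ { (g , _ , g≺ , _) → ¬≺one g g≺ })

≺X⇒constant : ∀ g → g ≺ X → Constant g
≺X⇒constant g g≺X with constant-or-atLeastX g
... | inj₁ g-const = g-const
... | inj₂ g≥x     = ⊥-elim (≼⇒≯ X g (eventually-from 1 g≥x) g≺X)

X-isComponent : IsComponent X
X-isComponent = ¬sum , ¬product
  where
  ¬sum : ¬ (Σ Sk λ g → Σ Sk λ h → g ≺ X × h ≺ X × X ≈ (g ⊕ h))
  ¬sum (g , h , _ , _ , e) = >⇒≢ (+-mono-≤ (⟦⟧>0 g 0) (⟦⟧>0 h 0)) (sym (e 0))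
  ¬product : ¬ (Σ Sk λ g → Σ Sk λ h → g ≺ X × h ≺ X × X ≈ (g ⊗ h))
  ¬product (g , h , g≺ , h≺ , e) with ≺X⇒constant g g≺ | ≺X⇒constant h h≺
  ... | a , g≡a | b , h≡b = contradiction (trans (value 0) (sym (value 1))) λ ()
    where
    value : ∀ n → suc n ≡ a * b
    value n = trans (e n) (cong₂ _*_ (g≡a n) (h≡b n))

prime∤1 : ∀ {p} → Prime p → p ∤ 1
prime∤1 p-prime p∣1 = nonTrivial⇒≢1 {{prime⇒nonTrivial p-prime}} (∣1⇒≡1 p∣1)

prime∣^⇒∣ : ∀ {p} m n → Prime p → p ∣ m ^ n → p ∣ m
prime∣^⇒∣ m zero    p-prime p∣1 = contradiction p∣1 (prime∤1 p-prime)
prime∣^⇒∣ m (suc n) p-prime p∣m*mⁿ with euclidsLemma m (m ^ n) p-prime p∣m*mⁿ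
... | inj₁ p∣m  = p∣m
... | inj₂ p∣mⁿ = prime∣^⇒∣ m n p-prime p∣mⁿ

-- A term with value 1 at 1 is built from 1 and X by products and by powers whose base again has
-- value 1 at 1; all of these are ≡ 1 (mod p) at 1 + p.
∤-at-1+p : ∀ {p} → Prime p → ∀ g → ⟦ g ⟧ 1 ≡ 1 → p ∤ ⟦ g ⟧ (suc p)
∤-at-1+p p-prime one _ = prime∤1 p-prime
∤-at-1+p {p} p-prime X _ p∣1+p =
  prime∤1 p-prime (∣m+n∣m⇒∣n (subst (p ∣_) (+-comm 1 p) p∣1+p) n∣n)
∤-at-1+p p-prime (f ⊕ g) f₁+g₁≡1 =
  contradiction f₁+g₁≡1 (>⇒≢ (+-mono-≤ (⟦⟧>0 f 0) (⟦⟧>0 g 0)))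
∤-at-1+p p-prime (f ⊗ g) f₁g₁≡1 p∣fg with euclidsLemma _ _ p-prime p∣fg
... | inj₁ p∣f = ∤-at-1+p p-prime f (m*n≡1⇒m≡1 _ _ f₁g₁≡1) p∣f
... | inj₂ p∣g = ∤-at-1+p p-prime g (m*n≡1⇒n≡1 (⟦ f ⟧ 1) _ f₁g₁≡1) p∣g
∤-at-1+p {p} p-prime (f ⊛ g) f₁^g₁≡1 p∣f^g
  with m^n≡1⇒n≡0∨m≡1 (⟦ f ⟧ 1) (⟦ g ⟧ 1) f₁^g₁≡1
... | inj₁ g₁≡0 = contradiction g₁≡0 (>⇒≢ (⟦⟧>0 g 0))
... | inj₂ f₁≡1 = ∤-at-1+p p-prime f f₁≡1 (prime∣^⇒∣ _ (⟦ g ⟧ (suc p)) p-prime p∣f^g)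

prime-power-factor≡1 : ∀ {p} → Prime p → ∀ m x y → x * y ≡ p ^ m → p ∤ x → x ≡ 1
prime-power-factor≡1 p-prime zero x y xy≡1 _ = m*n≡1⇒m≡1 x y xy≡1
prime-power-factor≡1 {p} p-prime (suc m) x y xy≡pᵐ⁺¹ p∤x
  with euclidsLemma x y p-prime (divides (p ^ m) (trans xy≡pᵐ⁺¹ (*-comm p (p ^ m))))
... | inj₁ p∣x = contradiction p∣x p∤x
... | inj₂ (divides z y≡zp) = prime-power-factor≡1 p-prime m x z
  (*-cancelʳ-≡ (x * z) (p ^ m) p {{prime⇒nonZero p-prime}} (begin
    x * z * p     ≡⟨ *-assoc x z p ⟩
    x * (z * p)   ≡⟨ cong (x *_) y≡zp ⟨
    x * y         ≡⟨ xy≡pᵐ⁺¹ ⟩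
    p * p ^ m     ≡⟨ *-comm p (p ^ m) ⟩
    p ^ m * p     ∎)) p∤x
  where open ≡-Reasoning

prime-factors : ∀ {p x y} → Prime p → x * y ≡ p → x ≡ 1 ⊎ y ≡ 1
prime-factors {p} {x} {y} p-prime xy≡p
  with prime⇒irreducible p-prime (divides y (trans (sym xy≡p) (*-comm x y)))
... | inj₁ x≡1 = inj₁ x≡1
... | inj₂ x≡p = inj₂ (*-cancelˡ-≡ y 1 p {{prime⇒nonZero p-prime}}
                        (trans (cong (_* y) (sym x≡p)) (trans xy≡p (sym (*-identityʳ p)))))

prime^X-factor≈one : ∀ p g h → Prime p → (numeral p ⊛ X) ≈ (g ⊗ h) →
                     ⟦ g ⟧ 1 ≡ 1 → g ≈ one
prime^X-factor≈one 0 _ _ p-prime = contradiction p-prime ¬prime[0]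
prime^X-factor≈one 1 _ _ p-prime = contradiction p-prime ¬prime[1]
prime^X-factor≈one p@(suc (suc r)) g h p-prime e g₁≡1 =
  ≡1⇒≈one g (suc r) (prime-power-factor≡1 p-prime (suc p) _ (⟦ h ⟧ (suc p))
    (sym (trans (cong (_^ suc p) (sym (⟦numeral⟧ p (suc p)))) (e p))) (∤-at-1+p p-prime g g₁≡1))

cofactor-of-one-≮ : ∀ f g h → g ≈ one → f ≈ (g ⊗ h) → ¬ (h ≺ f)
cofactor-of-one-≮ f g h g≈1 e =
  ≼⇒≯ f h (≈⇒≼ f h λ n → trans (e n) (⊗-oneˡ g h g≈1 n))

[1+q]^X-¬sum : ∀ q g h → g ≺ (numeral (suc q) ⊛ X) → h ≺ (numeral (suc q) ⊛ X) →
               ¬ ((numeral (suc q) ⊛ X) ≈ (g ⊕ h))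
[1+q]^X-¬sum q g h g≺ h≺ e =
  ¬polyExpBounded-[1+q]^ q (transfer (polyExpBounded-+ q ⟦ g ⟧ ⟦ h ⟧
    (below-[1+q]^X⇒polyExpBounded q g g≺) (below-[1+q]^X⇒polyExpBounded q h h≺)))
  where
  transfer : PolyExpBounded q (λ n → ⟦ g ⟧ n + ⟦ h ⟧ n) → PolyExpBounded q (suc q ^_)
  transfer (A , K , bounded) = A , K , λ n →
    subst (_≤ ⟦ mono A K q ⟧ᵐ (suc n))
          (trans (sym (e n)) (cong (_^ suc n) (⟦numeral⟧ (suc q) (suc n)))) (bounded n)

prime^X-¬product : ∀ p g h → Prime p → g ≺ (numeral p ⊛ X) → h ≺ (numeral p ⊛ X) →
                   ¬ ((numeral p ⊛ X) ≈ (g ⊗ h))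
prime^X-¬product 0 _ _ p-prime = contradiction p-prime ¬prime[0]
prime^X-¬product p@(suc _) g h p-prime g≺ h≺ e with prime-factors p-prime (sym p≡g₁h₁)
  where
  p≡g₁h₁ : p ≡ ⟦ g ⟧ 1 * ⟦ h ⟧ 1
  p≡g₁h₁ = trans (sym (*-identityʳ p)) (trans (cong (_^ 1) (sym (⟦numeral⟧ p 1))) (e 0))
... | inj₁ g₁≡1 =
  cofactor-of-one-≮ (numeral p ⊛ X) g h (prime^X-factor≈one p g h p-prime e g₁≡1) e h≺
... | inj₂ h₁≡1 =
  cofactor-of-one-≮ (numeral p ⊛ X) h g (prime^X-factor≈one p h g p-prime e′ h₁≡1) e′ g≺
  where
  e′ : (numeral p ⊛ X) ≈ (h ⊗ g)
  e′ n = trans (e n) (⊗-comm-≈ g h n)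

prime^X-isComponent : ∀ p → Prime p → IsComponent (numeral p ⊛ X)
prime^X-isComponent 0 p-prime = contradiction p-prime ¬prime[0]
prime^X-isComponent (suc q) p-prime =
  (λ { (g , h , g≺ , h≺ , e) → [1+q]^X-¬sum q g h g≺ h≺ e }) ,
  (λ { (g , h , g≺ , h≺ , e) → prime^X-¬product (suc q) g h p-prime g≺ h≺ e })

oneXOrPrime^X⇒lowComponent : ∀ f → OneXOrPrime^X f → LowComponent f
oneXOrPrime^X⇒lowComponent f (inj₁ f≈1) =
  LowComponent-resp-≈ one f (λ n → sym (f≈1 n))
    (one-isComponent , ≺-trans one X (X ⊛ X) (numeral≺X 1) X≺X^X)
oneXOrPrime^X⇒lowComponent f (inj₂ (inj₁ f≈X)) =
  LowComponent-resp-≈ X f (λ n → sym (f≈X n)) (X-isComponent , X≺X^X)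
oneXOrPrime^X⇒lowComponent f (inj₂ (inj₂ (p , p-prime , f≈p^X))) =
  LowComponent-resp-≈ (numeral p ⊛ X) f (λ n → sym (f≈p^X n))
    (prime^X-isComponent p p-prime , numeral^X≺X^X p)

mainTheorem13 : (f : Sk) →
    (IsComponent f × f ≺ (X ⊛ X)) ⇔
      (f ≈ one ⊎ f ≈ X ⊎ Σ ℕ (λ p → Prime p × f ≈ (numeral p ⊛ X)))
mainTheorem13 f = mk⇔ (classified f) (oneXOrPrime^X⇒lowComponent f)
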